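{- Let $w$ be a word and suppose $(h_1,p_1)<(h_2,p_2)<\cdots<(h_s,p_s)$ are Abelian periods of $w$ such that $(|w|-h_i)\bmod p_i=t$ for all $1\le i\le s$, for some common integer $t>0$. For any letter $a\in\Sigma$, if $(h_1,p_1)$ is an Abelian period of $wa$, then $(h_2,p_2),\dots,(h_s,p_s)$ are also Abelian periods of $wa$.
   Context: Let $\Sigma=\{a_1,\dots,a_\sigma\}$ be a finite alphabet. For a word $u$, $|u|_b$ is the number of occurrences of letter $b$ in $u$, the Parikh vector is $\mathcal{P}_u=(|u|_{a_1},\dots,|u|_{a_\sigma})$ and its norm $|\mathcal{P}_u|$ is the sum of components. For Parikh vectors, $\mathcal{P}\subset\mathcal{Q}$ means $\mathcal{P}[j]\le\mathcal{Q}[j]$ for all $j$ and $|\mathcal{P}|<|\mathcal{Q}|$. A word $u$ has Abelian period $(h,p)$ if $u=u_0u_1\cdots u_{k-1}u_k$ for some $k\ge2$ with $\mathcal{P}_{u_0}\subset\mathcal{P}_{u_1}=\cdots=\mathcal{P}_{u_{k-1}}\supset\mathcal{P}_{u_k}$, $|u_0|=h$, $|u_1|=p$; the length of the tail $u_k$ is then $(|u|-h)\bmod p$. Abelian periods are ordered by $(h,p)<(h',p')$ iff $p<p'$, or $p=p'$ and $h<h'$. $wa$ denotes the concatenation of $w$ with the letter $a$. -}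

module Defs where

open import Data.Nat using (ℕ; zero; suc; _+_; _∸_; _≤_; _<_)
open import Data.Nat.DivMod using (_%_)
open import Data.Fin using (Fin; zero; suc)
open import Data.List using (List; []; _∷_; _++_; length; concat)
open import Data.List.Relation.Unary.All using (All)
open import Data.Product using (Σ; _×_; ∃-syntax; _,_)
open import Data.Sum using (_⊎_)
open import Relation.Binary.PropositionalEquality using (_≡_)
open import Relation.Nullary using (yes; no)
open import Data.Fin using (_≟_)

Word : ℕ → Set
Word σ = List (Fin σ)

occ : ∀ {σ} → Fin σ → Word σ → ℕ
occ b [] = 0
occ b (c ∷ u) with c ≟ b
... | yes _ = suc (occ b u)
... | no  _ = occ b u

ParikhVec : ℕ → Set
ParikhVec σ = Fin σ → ℕ

parikh : ∀ {σ} → Word σ → ParikhVec σ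
parikh u j = occ j u

norm : ∀ {σ} → ParikhVec σ → ℕ
norm {zero}  P = 0
norm {suc σ} P = P zero + norm (λ j → P (suc j))

_≐_ : ∀ {σ} → ParikhVec σ → ParikhVec σ → Set
P ≐ Q = ∀ j → P j ≡ Q j

_⊂_ : ∀ {σ} → ParikhVec σ → ParikhVec σ → Set
P ⊂ Q = (∀ j → P j ≤ Q j) × (norm P < norm Q)

-- u has Abelian period (h,p): u = u0 u1 ... u_{k-1} u_k with k ≥ 2,
-- P_{u0} ⊂ P_{u1} = ... = P_{u_{k-1}} ⊃ P_{uk}, |u0| = h, |u1| = p.
-- Here u1 is the first middle block and `rest` = u2 ... u_{k-1} (possibly empty, k ≥ 2).
AbelianPeriod : ∀ {σ} → Word σ → ℕ → ℕ → Set
AbelianPeriod {σ} u h p =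
  Σ (Word σ) λ u0 → Σ (Word σ) λ u1 → Σ (List (Word σ)) λ rest → Σ (Word σ) λ uk →
    (u ≡ u0 ++ u1 ++ concat rest ++ uk)
    × (parikh u0 ⊂ parikh u1)
    × All (λ v → parikh v ≐ parikh u1) rest
    × (parikh uk ⊂ parikh u1)
    × (length u0 ≡ h)
    × (length u1 ≡ p)

_<AP_ : ℕ × ℕ → ℕ × ℕ → Set
(h , p) <AP (h' , p') = (p < p') ⊎ ((p ≡ p') × (h < h'))

-- m mod p (p > 0 for every Abelian period; the p = 0 clause is never used)
_mod_ : ℕ → ℕ → ℕ
m mod zero    = m
m mod (suc k) = m % suc k

_·_ : ∀ {σ} → Word σ → Fin σ → Word σ
w · a = w ++ (a ∷ [])

module Submission where

-- Fix an Abelian period (h,p) of w with factorisation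
-- w = u₀ u₁ ⋯ u_{k-1} u_k.  Appending a letter a can only affect the tail:
-- (h,p) is again an Abelian period of wa exactly when the tail still has room
-- for one more a, i.e. |u_k|_a < |u₁|_a.  The direction "⇐" is
-- 'extend-period' (u_k a becomes the new tail, or a new full block when it
-- reaches length p); the direction "⇒" is 'extension-deficit' (the suffix
-- u_k a of wa is either the tail or the last full block of wa).
-- Now let (h₁,p₁) and (hᵢ,pᵢ) be Abelian periods of w with tails of the
-- common length t and p₁ ≤ pᵢ.  Then the two tails coincide, and the last
-- full block for p₁ is a suffix of the last full block for pᵢ, so the
-- Parikh vector of the p₁-block is dominated by that of the pᵢ-block
-- ('block-dominance').  Hence the deficit of a in the tail for (h₁,p₁),
-- provided by 'extension-deficit', transfers to (hᵢ,pᵢ), and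
-- 'extend-period' finishes the proof of proposition8.

open import Defs
open import Data.Nat using (ℕ; zero; suc; _+_; _*_; _∸_; _≤_; _<_; z≤n; s≤s)
open import Data.Nat.Properties
open import Algebra.Properties.CommutativeSemigroup +-commutativeSemigroup using (interchange)
open import Data.Nat.DivMod using (_%_; [m+kn]%n≡m%n; m<n⇒m%n≡m)
open import Data.Fin using (Fin; zero; suc; toℕ) renaming (_≟_ to _≟F_)
open import Data.List using (List; []; _∷_; _++_; length; concat)
open import Data.List.Properties
  using (++-assoc; ++-identityʳ; ++-cancelʳ; length-++; concat-++; ∷-injective)
open import Data.List.Relation.Unary.All using (All; []; _∷_)
open import Data.List.Relation.Unary.All.Properties using (++⁺)
open import Data.Product using (Σ; _×_; _,_; proj₁; proj₂)
open import Data.Sum using (_⊎_; inj₁; inj₂)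
open import Relation.Binary.PropositionalEquality
open import Relation.Nullary using (yes; no; Dec)
open import Data.Empty using (⊥-elim)

occ-++ : ∀ {σ} (b : Fin σ) (x y : Word σ) → occ b (x ++ y) ≡ occ b x + occ b y
occ-++ b []      y = refl
occ-++ b (c ∷ x) y with c ≟F b
... | yes _ = cong suc (occ-++ b x y)
... | no  _ = occ-++ b x y

occ-self : ∀ {σ} (b : Fin σ) → occ b (b ∷ []) ≡ 1
occ-self b with b ≟F b
... | yes _  = refl
... | no b≢b = ⊥-elim (b≢b refl)

occ-other : ∀ {σ} (b c : Fin σ) → c ≢ b → occ b (c ∷ []) ≡ 0
occ-other b c c≢b with c ≟F b
... | yes c≡b = ⊥-elim (c≢b c≡b)
... | no  _   = refl

occ-snoc : ∀ {σ} (a : Fin σ) (x : Word σ) → occ a (x ++ a ∷ []) ≡ suc (occ a x)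
occ-snoc a x = trans (occ-++ a x (a ∷ [])) (trans (cong (occ a x +_) (occ-self a)) (+-comm (occ a x) 1))

occ-suc : ∀ {σ} (j c : Fin σ) → occ (suc j) (suc c ∷ []) ≡ occ j (c ∷ [])
occ-suc j c with c ≟F j
... | yes _ = refl
... | no  _ = refl

norm-cong : ∀ {σ} {P Q : ParikhVec σ} → P ≐ Q → norm P ≡ norm Q
norm-cong {zero}  P≐Q = refl
norm-cong {suc σ} P≐Q = cong₂ _+_ (P≐Q zero) (norm-cong (λ j → P≐Q (suc j)))

norm-zero : ∀ {σ} → norm {σ} (λ _ → 0) ≡ 0
norm-zero {zero}  = refl
norm-zero {suc σ} = norm-zero {σ}

norm-+ : ∀ {σ} (P Q : ParikhVec σ) → norm (λ j → P j + Q j) ≡ norm P + norm Q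
norm-+ {zero}  P Q = refl
norm-+ {suc σ} P Q = begin
  P zero + Q zero + norm (λ j → P (suc j) + Q (suc j))
    ≡⟨ cong (P zero + Q zero +_) (norm-+ (λ j → P (suc j)) (λ j → Q (suc j))) ⟩
  P zero + Q zero + (norm (λ j → P (suc j)) + norm (λ j → Q (suc j)))
    ≡⟨ interchange (P zero) (Q zero) (norm (λ j → P (suc j))) (norm (λ j → Q (suc j))) ⟩
  P zero + norm (λ j → P (suc j)) + (Q zero + norm (λ j → Q (suc j))) ∎
  where open ≡-Reasoning

norm-letter : ∀ {σ} (c : Fin σ) → norm (parikh (c ∷ [])) ≡ 1
norm-letter {suc σ} zero =
  cong suc (trans (norm-cong {σ} (λ j → occ-other (suc j) zero (λ ()))) (norm-zero {σ}))
norm-letter {suc σ} (suc c) =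
  trans (cong₂ _+_ (occ-other zero (suc c) (λ ())) (norm-cong (λ j → occ-suc j c))) (norm-letter c)

norm-parikh : ∀ {σ} (u : Word σ) → norm (parikh u) ≡ length u
norm-parikh {σ} [] = norm-zero {σ}
norm-parikh (c ∷ u) = begin
  norm (parikh (c ∷ u))                        ≡⟨ norm-cong (λ j → occ-++ j (c ∷ []) u) ⟩
  norm (λ j → occ j (c ∷ []) + occ j u)        ≡⟨ norm-+ (parikh (c ∷ [])) (parikh u) ⟩
  norm (parikh (c ∷ [])) + norm (parikh u)     ≡⟨ cong₂ _+_ (norm-letter c) (norm-parikh u) ⟩
  suc (length u)                               ∎
  where open ≡-Reasoning

norm-mono : ∀ {σ} {P Q : ParikhVec σ} → (∀ j → P j ≤ Q j) → norm P ≤ norm Q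
norm-mono {zero}  P≤Q = z≤n
norm-mono {suc σ} P≤Q = +-mono-≤ (P≤Q zero) (norm-mono (λ j → P≤Q (suc j)))

dominated-equal-norm : ∀ {σ} {P Q : ParikhVec σ} →
  (∀ j → P j ≤ Q j) → norm P ≡ norm Q → P ≐ Q
dominated-equal-norm {suc σ} {P} {Q} P≤Q same = pointwise
  where
  P′ Q′ : ParikhVec σ
  P′ j = P (suc j)
  Q′ j = Q (suc j)
  Q₀≤P₀ : Q zero ≤ P zero
  Q₀≤P₀ = +-cancelʳ-≤ (norm Q′) (Q zero) (P zero)
    (≤-trans (≤-reflexive (sym same)) (+-monoʳ-≤ (P zero) (norm-mono (λ j → P≤Q (suc j)))))
  P₀≡Q₀ : P zero ≡ Q zero
  P₀≡Q₀ = ≤-antisym (P≤Q zero) Q₀≤P₀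
  same′ : norm P′ ≡ norm Q′
  same′ = +-cancelˡ-≡ (P zero) (norm P′) (norm Q′) (trans same (cong (_+ norm Q′) (sym P₀≡Q₀)))
  pointwise : P ≐ Q
  pointwise zero    = P₀≡Q₀
  pointwise (suc j) = dominated-equal-norm (λ j → P≤Q (suc j)) same′ j

≐-length : ∀ {σ} (x y : Word σ) → parikh x ≐ parikh y → length x ≡ length y
≐-length x y x≐y = trans (sym (norm-parikh x)) (trans (norm-cong x≐y) (norm-parikh y))

⊂-shorter : ∀ {σ} (x y : Word σ) → parikh x ⊂ parikh y → length x < length y
⊂-shorter x y (_ , lt) = subst₂ _<_ (norm-parikh x) (norm-parikh y) lt

length-snoc : ∀ {A : Set} (xs : List A) (x : A) → length (xs ++ x ∷ []) ≡ suc (length xs)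
length-snoc xs x = trans (length-++ xs) (+-comm (length xs) 1)

empty-of-length-zero : ∀ {A : Set} {xs : List A} → length xs ≡ 0 → xs ≡ []
empty-of-length-zero {xs = []} refl = refl

prefixes-agree : ∀ {A : Set} (xs ys zs ws : List A) →
  xs ++ ys ≡ zs ++ ws → length xs ≡ length zs → xs ≡ zs × ys ≡ ws
prefixes-agree []       ys []       ws eq _ = refl , eq
prefixes-agree (x ∷ xs) ys (z ∷ zs) ws eq same with ∷-injective eq
... | refl , eq′ with prefixes-agree xs ys zs ws eq′ (suc-injective same)
... | xs≡zs , ys≡ws = cong (x ∷_) xs≡zs , ys≡ws

suffix-split : ∀ {A : Set} (xs ys zs ws : List A) →
  xs ++ ys ≡ zs ++ ws → length ys ≤ length ws → Σ (List A) λ vs → ws ≡ vs ++ ys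
suffix-split xs       ys []       ws eq _ = xs , sym eq
suffix-split []       ys (z ∷ zs) ws eq ys≤ws =
  ⊥-elim (<⇒≱ (s≤s (m≤n+m (length ws) (length zs)))
                (subst (_≤ length ws) (trans (cong length eq) (length-++ (z ∷ zs))) ys≤ws))
suffix-split (x ∷ xs) ys (z ∷ zs) ws eq ys≤ws = suffix-split xs ys zs ws (proj₂ (∷-injective eq)) ys≤ws

suffixes-agree : ∀ {A : Set} (xs ys zs ws : List A) →
  xs ++ ys ≡ zs ++ ws → length ys ≡ length ws → ys ≡ ws
suffixes-agree xs ys zs ws eq same with suffix-split xs ys zs ws eq (≤-reflexive same)
... | [] , refl = refl
... | v ∷ vs , refl = ⊥-elim (<-irrefl (trans same (length-++ (v ∷ vs)))
                                         (s≤s (m≤n+m (length ys) (length vs))))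

suffix-occ-mono : ∀ {σ} (b : Fin σ) (xs ys zs ws : Word σ) →
  xs ++ ys ≡ zs ++ ws → length ys ≤ length ws → occ b ys ≤ occ b ws
suffix-occ-mono b xs ys zs ws eq ys≤ws with suffix-split xs ys zs ws eq ys≤ws
... | vs , refl = subst (occ b ys ≤_) (sym (occ-++ b vs ys)) (m≤n+m (occ b ys) (occ b vs))

residue-unique : ∀ {p x y} k l → x < p → y < p → x + k * p ≡ y + l * p → x ≡ y
residue-unique {suc p} {x} {y} k l x<p y<p eq = begin
  x                       ≡⟨ m<n⇒m%n≡m x<p ⟨
  x % suc p               ≡⟨ [m+kn]%n≡m%n x k (suc p) ⟨
  (x + k * suc p) % suc p ≡⟨ cong (_% suc p) eq ⟩
  (y + l * suc p) % suc p ≡⟨ [m+kn]%n≡m%n y l (suc p) ⟩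
  y % suc p               ≡⟨ m<n⇒m%n≡m y<p ⟩
  y                       ∎
  where open ≡-Reasoning

successor-residue : ∀ {p x y} k l → x < p → y < p → suc x + k * p ≡ y + l * p →
  (suc x < p × y ≡ suc x) ⊎ (suc x ≡ p × y ≡ 0)
successor-residue {p} {x} {y} k l x<p y<p eq with m≤n⇒m<n∨m≡n x<p
... | inj₁ 1+x<p = inj₁ (1+x<p , sym (residue-unique k l 1+x<p y<p eq))
... | inj₂ refl  = inj₂ (refl , residue-unique l (suc k) y<p (s≤s z≤n) (sym eq))

residue-of-length : ∀ {h p r} n k → n ≡ h + (r + k * p) → r < p → (n ∸ h) mod p ≡ r
residue-of-length {h} {suc p} {r} n k refl r<p =
  trans (cong (_% suc p) (m+n∸m≡n h (r + k * suc p)))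
        (trans ([m+kn]%n≡m%n r k (suc p)) (m<n⇒m%n≡m r<p))

record Factorisation {σ} (u : Word σ) (h p : ℕ) : Set where
  field
    head block   : Word σ
    middle       : List (Word σ)
    tail         : Word σ
    split        : u ≡ head ++ block ++ concat middle ++ tail
    head⊂block   : parikh head ⊂ parikh block
    middle≐block : All (λ v → parikh v ≐ parikh block) middle
    tail⊂block   : parikh tail ⊂ parikh block
    head-length  : length head ≡ h
    block-length : length block ≡ p

open Factorisation

factorisation : ∀ {σ} {u : Word σ} {h p} → AbelianPeriod u h p → Factorisation u h p
factorisation (u₀ , u₁ , rest , uₖ , eq , u₀⊂ , rest≐ , uₖ⊂ , |u₀| , |u₁|) =
  record { head = u₀ ; block = u₁ ; middle = rest ; tail = uₖ ; split = eq
         ; head⊂block = u₀⊂ ; middle≐block = rest≐ ; tail⊂block = uₖ⊂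
         ; head-length = |u₀| ; block-length = |u₁| }

length-concat-≐ : ∀ {σ} (x : Word σ) (vs : List (Word σ)) →
  All (λ v → parikh v ≐ parikh x) vs → length (concat vs) ≡ length vs * length x
length-concat-≐ x []       []         = refl
length-concat-≐ x (v ∷ vs) (v≐ ∷ vs≐) =
  trans (length-++ v) (cong₂ _+_ (≐-length v x v≐) (length-concat-≐ x vs vs≐))

length-factorised : ∀ {σ} {u : Word σ} {h p} (F : Factorisation u h p) →
  length u ≡ h + (length (tail F) + suc (length (middle F)) * p)
length-factorised {u = u} {h} {p} F = begin
  length u                                           ≡⟨ cong length (split F) ⟩
  length (head F ++ block F ++ concat (middle F) ++ tail F)
    ≡⟨ trans (length-++ (head F)) (cong (length (head F) +_) (trans (length-++ (block F))
         (cong (length (block F) +_) (length-++ (concat (middle F)))))) ⟩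
  length (head F) + (length (block F) + (length (concat (middle F)) + t))
    ≡⟨ cong₂ (λ a b → a + (b + (length (concat (middle F)) + t))) (head-length F) (block-length F) ⟩
  h + (p + (length (concat (middle F)) + t))
    ≡⟨ cong (λ c → h + (p + (c + t))) (trans (length-concat-≐ (block F) (middle F) (middle≐block F))
                                             (cong (length (middle F) *_) (block-length F))) ⟩
  h + (p + (length (middle F) * p + t))
    ≡⟨ cong (h +_) (trans (sym (+-assoc p _ t)) (+-comm (p + length (middle F) * p) t)) ⟩
  h + (t + suc (length (middle F)) * p) ∎
  where
  open ≡-Reasoning
  t : ℕ
  t = length (tail F)

tail-shorter : ∀ {σ} {u : Word σ} {h p} (F : Factorisation u h p) → length (tail F) < p
tail-shorter F = subst (length (tail F) <_) (block-length F) (⊂-shorter (tail F) (block F) (tail⊂block F))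

tail-length : ∀ {σ} {u : Word σ} {h p} (F : Factorisation u h p) →
  length (tail F) ≡ (length u ∸ h) mod p
tail-length {u = u} {h} {p} F =
  sym (residue-of-length {h = h} {p = p} (length u) (suc (length (middle F))) (length-factorised F) (tail-shorter F))

last-of-blocks : ∀ {σ} {Q : ParikhVec σ} (X B : Word σ) (rest : List (Word σ)) →
  parikh B ≐ Q → All (λ v → parikh v ≐ Q) rest →
  Σ (Word σ) λ Y → Σ (Word σ) λ L → X ++ B ++ concat rest ≡ Y ++ L × parikh L ≐ Q
last-of-blocks X B []       B≐ []          = X , B , cong (X ++_) (++-identityʳ B) , B≐
last-of-blocks X B (r ∷ rs) B≐ (r≐ ∷ rs≐) with last-of-blocks (X ++ B) r rs r≐ rs≐
... | Y , L , eq , L≐ = Y , L , trans (sym (++-assoc X B (r ++ concat rs))) eq , L≐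

last-block : ∀ {σ} {u : Word σ} {h p} (F : Factorisation u h p) →
  Σ (Word σ) λ Y → Σ (Word σ) λ L → u ≡ (Y ++ L) ++ tail F × parikh L ≐ parikh (block F)
last-block F with last-of-blocks (head F) (block F) (middle F) (λ _ → refl) (middle≐block F)
... | Y , L , eq , L≐ = Y , L , trans (split F) regroup , L≐
  where
  regroup : head F ++ block F ++ concat (middle F) ++ tail F ≡ (Y ++ L) ++ tail F
  regroup = trans (cong (head F ++_) (sym (++-assoc (block F) (concat (middle F)) (tail F))))
           (trans (sym (++-assoc (head F) _ (tail F))) (cong (_++ tail F) eq))

snoc-dominated : ∀ {σ} (x y : Word σ) (a : Fin σ) → (∀ j → occ j x ≤ occ j y) →
  occ a x < occ a y → ∀ j → occ j (x ++ a ∷ []) ≤ occ j y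
snoc-dominated x y a x≤y deficit j =
  subst (_≤ occ j y) (sym (occ-++ j x (a ∷ []))) (count (a ≟F j))
  where
  count : Dec (a ≡ j) → occ j x + occ j (a ∷ []) ≤ occ j y
  count (yes refl) = subst (_≤ occ a y) (sym (trans (cong (occ a x +_) (occ-self a)) (+-comm _ 1))) deficit
  count (no a≢j)   = subst (_≤ occ j y) (sym (trans (cong (occ j x +_) (occ-other j a a≢j)) (+-identityʳ _))) (x≤y j)

split-snoc : ∀ {σ} {u : Word σ} {h p} (F : Factorisation u h p) (a : Fin σ) →
  u · a ≡ head F ++ block F ++ concat (middle F) ++ (tail F ++ a ∷ [])
split-snoc F a = trans (cong (_++ a ∷ []) (split F))
  (trans (++-assoc (head F) _ _) (cong (head F ++_) (trans (++-assoc (block F) _ _)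
    (cong (block F ++_) (++-assoc (concat (middle F)) (tail F) (a ∷ []))))))

-- If the tail lacks an occurrence of a, then (h,p) survives appending a:
-- tail·a is the new tail, or a new full block when it reaches length p.
extend-period : ∀ {σ} {w : Word σ} {h p} (F : Factorisation w h p) (a : Fin σ) →
  occ a (tail F) < occ a (block F) → AbelianPeriod (w · a) h p
extend-period {σ} {w} F a deficit with m≤n⇒m<n∨m≡n (⊂-shorter (tail F) (block F) (tail⊂block F))
... | inj₁ room =
  head F , block F , middle F , tail′ , split-snoc F a , head⊂block F , middle≐block F ,
  (dominated , subst₂ _<_ (sym (norm-parikh tail′)) (sym (norm-parikh (block F)))
                          (subst (_< length (block F)) (sym (length-snoc (tail F) a)) room)) ,
  head-length F , block-length F
  where
  tail′ : Word σ
  tail′ = tail F ++ a ∷ []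
  dominated : ∀ j → occ j tail′ ≤ occ j (block F)
  dominated = snoc-dominated (tail F) (block F) a (proj₁ (tail⊂block F)) deficit
... | inj₂ full =
  head F , block F , middle F ++ tail′ ∷ [] , [] , split′ , head⊂block F ,
  ++⁺ (middle≐block F) (tail′≐block ∷ []) ,
  ((λ _ → z≤n) , subst₂ _<_ (sym (norm-zero {σ})) (sym (norm-parikh (block F)))
                             (subst (0 <_) full (s≤s z≤n))) ,
  head-length F , block-length F
  where
  tail′ : Word σ
  tail′ = tail F ++ a ∷ []
  tail′≐block : parikh tail′ ≐ parikh (block F)
  tail′≐block = dominated-equal-norm (snoc-dominated (tail F) (block F) a (proj₁ (tail⊂block F)) deficit)
    (trans (norm-parikh tail′) (trans (length-snoc (tail F) a) (trans full (sym (norm-parikh (block F))))))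
  split′ : w · a ≡ head F ++ block F ++ concat (middle F ++ tail′ ∷ []) ++ []
  split′ = trans (split-snoc F a) (cong (λ z → head F ++ block F ++ z)
    (trans (cong (concat (middle F) ++_) (sym (++-identityʳ tail′)))
           (trans (concat-++ (middle F) (tail′ ∷ [])) (sym (++-identityʳ _)))))

shared-block : ∀ {σ} {u : Word σ} {h p} {a : Fin σ} (F : Factorisation u h p) →
  (G : Factorisation (u · a) h p) → block G ≡ block F
shared-block {a = a} F G =
  proj₁ (prefixes-agree (block G) _ (block F) _ after-head (trans (block-length G) (sym (block-length F))))
  where
  after-head : block G ++ concat (middle G) ++ tail G ≡ block F ++ concat (middle F) ++ (tail F ++ a ∷ [])
  after-head = proj₂ (prefixes-agree (head G) _ (head F) _ (trans (sym (split G)) (split-snoc F a))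
                        (trans (head-length G) (sym (head-length F))))

snoc-suffix : ∀ {σ} {u : Word σ} {h p} {a : Fin σ} (F : Factorisation u h p) (Y S : Word σ) →
  u · a ≡ Y ++ S → length S ≡ suc (length (tail F)) → S ≡ tail F ++ a ∷ []
snoc-suffix {a = a} F Y S ua≡ len with last-block F
... | X , B , u≡ , _ = suffixes-agree Y S (X ++ B) (tail F ++ a ∷ []) Y·S≡ (trans len (sym (length-snoc (tail F) a)))
  where
  Y·S≡ : Y ++ S ≡ (X ++ B) ++ (tail F ++ a ∷ [])
  Y·S≡ = trans (sym ua≡) (trans (cong (_++ a ∷ []) u≡) (++-assoc (X ++ B) (tail F) (a ∷ [])))

snoc-residues : ∀ {σ} {u : Word σ} {h p} {a : Fin σ} (F : Factorisation u h p) (G : Factorisation (u · a) h p) →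
  suc (length (tail F)) + suc (length (middle F)) * p ≡ length (tail G) + suc (length (middle G)) * p
snoc-residues {u = u} {h} {p} {a} F G = +-cancelˡ-≡ h _ _ (begin
  h + suc (length (tail F) + suc (length (middle F)) * p) ≡⟨ +-suc h _ ⟩
  suc (h + (length (tail F) + suc (length (middle F)) * p)) ≡⟨ cong suc (length-factorised F) ⟨
  suc (length u)                                            ≡⟨ length-snoc u a ⟨
  length (u · a)                                            ≡⟨ length-factorised G ⟩
  h + (length (tail G) + suc (length (middle G)) * p)       ∎)
  where open ≡-Reasoning

-- Converse of 'extend-period': if (h,p) is an Abelian period of both w and wa,
-- the tail of w lacks an occurrence of a: the suffix tail·a of wa is either the tail of wa
-- or, when that tail is empty, the last full block of wa.
extension-deficit : ∀ {σ} {w : Word σ} {h p} (a : Fin σ) (F : Factorisation w h p) →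
  Factorisation (w · a) h p → occ a (tail F) < occ a (block F)
extension-deficit {w = w} a F G =
  subst₂ _≤_ (occ-snoc a (tail F)) (cong (occ a) (shared-block F G)) suffix-bound
  where
  bounded : ∀ {S} → S ≡ tail F ++ a ∷ [] → occ a S ≤ occ a (block G) → occ a (tail F ++ a ∷ []) ≤ occ a (block G)
  bounded refl bound = bound
  suffix-bound : occ a (tail F ++ a ∷ []) ≤ occ a (block G)
  suffix-bound with last-block G
    | successor-residue (suc (length (middle F))) (suc (length (middle G)))
        (tail-shorter F) (tail-shorter G) (snoc-residues F G)
  ... | Y , L , wa≡ , _ | inj₁ (_ , longer) = bounded (snoc-suffix F (Y ++ L) (tail G) wa≡ longer) (proj₁ (tail⊂block G) a)
  ... | Y , L , wa≡ , L≐ | inj₂ (full , empty) = bounded (snoc-suffix F Y L wa≡Y·L |L|) (≤-reflexive (L≐ a))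
    where
    wa≡Y·L : w · a ≡ Y ++ L
    wa≡Y·L = trans wa≡ (trans (cong ((Y ++ L) ++_) (empty-of-length-zero empty)) (++-identityʳ (Y ++ L)))
    |L| : length L ≡ suc (length (tail F))
    |L| = trans (≐-length L (block G) L≐) (trans (block-length G) (sym full))

-- Two factorisations of u with equally long tails share the tail, and the
-- block of the smaller period is dominated letterwise by that of the larger:
-- the last full block of the first is a suffix of the last full block of the second.
block-dominance : ∀ {σ} {u : Word σ} {h p h′ p′} (F : Factorisation u h p) (F′ : Factorisation u h′ p′) →
  length (tail F) ≡ length (tail F′) → p ≤ p′ →
  tail F ≡ tail F′ × (∀ b → occ b (block F) ≤ occ b (block F′))
block-dominance F F′ same p≤p′ with last-block F | last-block F′
... | X , B , u≡ , B≐ | X′ , B′ , u≡′ , B′≐ = same-tail , dominated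
  where
  same-tail : tail F ≡ tail F′
  same-tail = suffixes-agree (X ++ B) (tail F) (X′ ++ B′) (tail F′) (trans (sym u≡) u≡′) same
  same-prefix : X ++ B ≡ X′ ++ B′
  same-prefix = ++-cancelʳ (tail F) (X ++ B) (X′ ++ B′)
    (trans (sym u≡) (trans u≡′ (cong ((X′ ++ B′) ++_) (sym same-tail))))
  |B|≤|B′| : length B ≤ length B′
  |B|≤|B′| = subst₂ _≤_ (sym (trans (≐-length B (block F) B≐) (block-length F)))
                        (sym (trans (≐-length B′ (block F′) B′≐) (block-length F′))) p≤p′
  dominated : ∀ b → occ b (block F) ≤ occ b (block F′)
  dominated b = subst₂ _≤_ (B≐ b) (B′≐ b) (suffix-occ-mono b X B X′ B′ same-prefix |B|≤|B′|)

-- Only two consequences of the hypotheses are used for the i-th period: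
-- p₁ ≤ pᵢ (from the order) and the equality of the tail lengths (both equal t).
proposition8 : ∀ {σ} (w : Word σ) (n : ℕ) (h p : Fin (suc n) → ℕ) (t : ℕ) →
    (∀ i j → toℕ i < toℕ j → (h i , p i) <AP (h j , p j)) →
    (∀ i → AbelianPeriod w (h i) (p i)) →
    (∀ i → (length w ∸ h i) mod (p i) ≡ t) →
    0 < t →
    (a : Fin σ) →
    AbelianPeriod (w · a) (h zero) (p zero) →
    ∀ i → AbelianPeriod (w · a) (h i) (p i)
proposition8 w _ h p _ ordered periods residues _ a extended zero = extended
proposition8 w _ h p _ ordered periods residues _ a extended (suc i) =
  extend-period Fᵢ a (subst (λ x → occ a x < occ a (block Fᵢ)) same-tail
                       (<-≤-trans (extension-deficit a F₁ (factorisation extended)) (dominated a)))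
  where
  F₁ : Factorisation w (h zero) (p zero)
  F₁ = factorisation (periods zero)
  Fᵢ : Factorisation w (h (suc i)) (p (suc i))
  Fᵢ = factorisation (periods (suc i))
  p₁≤pᵢ : p zero ≤ p (suc i)
  p₁≤pᵢ with ordered zero (suc i) (s≤s z≤n)
  ... | inj₁ p₁<pᵢ      = <⇒≤ p₁<pᵢ
  ... | inj₂ (p₁≡pᵢ , _) = ≤-reflexive p₁≡pᵢ
  equal-tail-lengths : length (tail F₁) ≡ length (tail Fᵢ)
  equal-tail-lengths = trans (tail-length F₁) (trans (residues zero) (sym (trans (tail-length Fᵢ) (residues (suc i)))))
  same-tail : tail F₁ ≡ tail Fᵢ
  same-tail = proj₁ (block-dominance F₁ Fᵢ equal-tail-lengths p₁≤pᵢ)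
  dominated : ∀ b → occ b (block F₁) ≤ occ b (block Fᵢ)
  dominated = proj₂ (block-dominance F₁ Fᵢ equal-tail-lengths p₁≤pᵢ)
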